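{- Let $k\ge 3$ and let $H$ be a caterpillar graph with central path $v_1v_2\cdots v_k$ such that $l(v_1)=l(v_2)=\cdots=l(v_{k-1})=0$ and $l(v_k)\ge 2$ (so $H$ consists of the path $v_1\cdots v_k$ together with $l(v_k)$ leaves attached to $v_k$). Then $\delta_H(H)=l(v_k)-1$.
   Context: A caterpillar graph is a tree containing a path (its central path) such that every vertex is at distance at most $1$ from that path; vertices off the path are leaves adjacent to path vertices. For a vertex $v$, $l(v)$ denotes the number of leaves adjacent to $v$. For a graph $G$, $\delta_H(G)$ (the Hamiltonian path complete number) is the minimum number of edges not in $E(G)$, joining vertices of $G$, whose addition to $G$ produces a graph containing a spanning (Hamiltonian) path. -}

module Defs where

open import Level using (0ℓ)
open import Data.Nat using (ℕ; suc; _+_; _∸_; _<_; _≤_)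
open import Data.Fin using (Fin; toℕ)
open import Data.Product using (_×_; _,_; Σ; ∃)
open import Data.Sum using (_⊎_)
open import Data.List using (List; length)
open import Data.List.Membership.Propositional using (_∈_)
open import Data.List.Relation.Unary.All using (All)
open import Data.List.Relation.Unary.Unique.Propositional using (Unique)
open import Relation.Nullary using (¬_)
open import Relation.Binary.PropositionalEquality using (_≡_)
open import Function.Definitions using (Bijective)

Graph : ℕ → Set₁
Graph n = Fin n → Fin n → Set

HasHamPath : ∀ {n} → Graph n → Set
HasHamPath {n} G =
  Σ (Fin n → Fin n) λ p →
    Bijective _≡_ _≡_ p ×
    (∀ (i j : Fin n) → suc (toℕ i) ≡ toℕ j → G (p i) (p j))

-- A set of new edges: each unordered edge {u,v} is listed once as (u , v)
-- with toℕ u < toℕ v (hence u ≠ v), no repetitions, and not already an edge of G.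
ValidNewEdges : ∀ {n} → Graph n → List (Fin n × Fin n) → Set
ValidNewEdges G F =
  Unique F × All (λ { (u , v) → (toℕ u < toℕ v) × ¬ G u v }) F

addEdges : ∀ {n} → Graph n → List (Fin n × Fin n) → Graph n
addEdges G F u v = G u v ⊎ ((u , v) ∈ F ⊎ (v , u) ∈ F)

HamCompletion : ∀ {n} → Graph n → List (Fin n × Fin n) → Set
HamCompletion G F = ValidNewEdges G F × HasHamPath (addEdges G F)

HamPathCompleteNumberIs : ∀ {n} → Graph n → ℕ → Set
HamPathCompleteNumberIs G d =
  (Σ _ λ F → HamCompletion G F × length F ≡ d) ×
  (∀ F → HamCompletion G F → d ≤ length F)

-- The caterpillar: central path v_1 … v_k (vertices 0 … k-1, v_i = i-1) and
-- m leaves (vertices k … k+m-1) all adjacent to v_k (vertex k-1).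
caterpillarEdge : (k m : ℕ) → Fin (k + m) → Fin (k + m) → Set
caterpillarEdge k m u v =
  (suc (toℕ u) ≡ toℕ v × toℕ v < k) ⊎ (toℕ u ≡ k ∸ 1 × k ≤ toℕ v)

caterpillar : (k m : ℕ) → Graph (k + m)
caterpillar k m u v = caterpillarEdge k m u v ⊎ caterpillarEdge k m v u

-- Listing the spine v₁ … v_k and then the leaves one after another needs the m − 1
-- new edges joining consecutive leaves.  Conversely, a Hamiltonian path has k + m − 1
-- edges, but at most k of them can be edges of the caterpillar: the k − 2 spine edges
-- avoiding v_k, and at most two edges at v_k (one entering it and one leaving it).
-- Hence at least m − 1 edges of the path are new.
module Submission where

open import Data.Nat using (ℕ; suc; _+_; _∸_; _<_; _≤_; s≤s)
open import Data.Nat.Properties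
  using (1+n≰n; <⇒≱; +-comm; +-suc; +-identityʳ; +-cancelˡ-≤; ∸-monoˡ-≤; m≤n⇒m<n∨m≡n)
import Data.Nat.Properties as ℕ
open import Data.Fin using (Fin; zero; suc; toℕ; fromℕ<; inject₁; splitAt; join; _↑ʳ_)
open import Data.Fin.Properties
  using (suc-injective; toℕ-injective; toℕ-inject₁; inject₁-injective; toℕ-fromℕ<; toℕ-↑ˡ; toℕ-↑ʳ;
         ↑ʳ-injective; splitAt-join; splitAt⁻¹-↑ˡ; splitAt⁻¹-↑ʳ; injective⇒≤; ≤̄⇒inject₁<; toℕ<n)
open import Data.Product using (Σ; _×_; _,_; proj₁; swap)
open import Data.Product.Properties using (,-injective)
open import Data.Sum using (_⊎_; inj₁; inj₂)
open import Data.Sum.Properties using (inj₁-injective; inj₂-injective)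
open import Data.List using (List; length; lookup; tabulate)
open import Data.List.Properties using (length-tabulate)
open import Data.List.Membership.Propositional using (_∈_)
open import Data.List.Membership.Propositional.Properties using (∈-tabulate⁺)
open import Data.List.Relation.Unary.Any using (index)
open import Data.List.Relation.Unary.Any.Properties using (lookup-index)
import Data.List.Relation.Unary.All.Properties as All
import Data.List.Relation.Unary.Unique.Propositional.Properties as Unique
open import Data.Empty using (⊥; ⊥-elim)
open import Function using (id)
open import Function.Definitions using (Injective)
open import Function.Construct.Identity using (bijective)
open import Relation.Nullary using (¬_)
open import Relation.Binary.PropositionalEquality
  using (_≡_; _≢_; refl; sym; trans; cong; subst)

open import Defs

SameEdge : {A : Set} → A × A → A × A → Set
SameEdge e e′ = e ≡ e′ ⊎ e ≡ swap e′

SameEdge-sym : {A : Set} {e e′ : A × A} → SameEdge e e′ → SameEdge e′ e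
SameEdge-sym (inj₁ refl) = inj₁ refl
SameEdge-sym (inj₂ refl) = inj₂ refl

SameEdge-trans : {A : Set} {e e′ e″ : A × A} → SameEdge e e′ → SameEdge e′ e″ → SameEdge e e″
SameEdge-trans (inj₁ refl) q           = q
SameEdge-trans (inj₂ refl) (inj₁ refl) = inj₂ refl
SameEdge-trans (inj₂ refl) (inj₂ refl) = inj₁ refl

SameEdge-swap : {A : Set} {e e′ : A × A} → SameEdge e e′ → SameEdge (swap e) e′
SameEdge-swap (inj₁ refl) = inj₂ refl
SameEdge-swap (inj₂ refl) = inj₁ refl

module InjectiveSequence {A : Set} {N : ℕ} (p : Fin (suc N) → A) (p-injective : Injective _≡_ _≡_ p) where

  step : Fin N → A × A
  step i = p (inject₁ i) , p (suc i)

  source-injective : ∀ {i j} → p (inject₁ i) ≡ p (inject₁ j) → i ≡ j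
  source-injective eq = inject₁-injective (p-injective eq)

  target-injective : ∀ {i j} → p (suc i) ≡ p (suc j) → i ≡ j
  target-injective eq = suc-injective (p-injective eq)

  step≢swap-step : ∀ i j → step i ≢ swap (step j)
  step≢swap-step i j eq with ,-injective eq
  ... | i≡1+j , 1+i≡j = no-2-cycle
    (trans (sym (toℕ-inject₁ i)) (cong toℕ (p-injective i≡1+j)))
    (trans (cong toℕ (p-injective 1+i≡j)) (toℕ-inject₁ j))
    where
      no-2-cycle : ∀ {x y} → x ≡ suc y → suc x ≡ y → ⊥
      no-2-cycle refl ()

  step-injective : ∀ {i j} → SameEdge (step i) (step j) → i ≡ j
  step-injective (inj₁ eq) = source-injective (proj₁ (,-injective eq))
  step-injective (inj₂ eq) = ⊥-elim (step≢swap-step _ _ eq)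

module _ {n : ℕ} (F : List (Fin n × Fin n)) where

  newEdgeIndex : ∀ {u v} → (u , v) ∈ F ⊎ (v , u) ∈ F → Fin (length F)
  newEdgeIndex (inj₁ uv∈F) = index uv∈F
  newEdgeIndex (inj₂ vu∈F) = index vu∈F

  lookup-newEdgeIndex : ∀ {u v} (e : (u , v) ∈ F ⊎ (v , u) ∈ F) →
                        SameEdge (u , v) (lookup F (newEdgeIndex e))
  lookup-newEdgeIndex (inj₁ uv∈F) = inj₁ (lookup-index uv∈F)
  lookup-newEdgeIndex (inj₂ vu∈F) = inj₂ (cong swap (lookup-index vu∈F))

module _ {n N : ℕ} {G : Graph n} {F : List (Fin n × Fin n)}
         (p : Fin (suc N) → Fin n) (p-injective : Injective _≡_ _≡_ p)
         (walk : ∀ i → addEdges G F (p (inject₁ i)) (p (suc i)))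
         {c : ℕ} (label : ∀ i → G (p (inject₁ i)) (p (suc i)) → Fin c)
         (label-injective : ∀ {i j} gi gj → label i gi ≡ label j gj → i ≡ j) where

  open InjectiveSequence p p-injective

  private
    code : ∀ i → addEdges G F (p (inject₁ i)) (p (suc i)) → Fin (length F) ⊎ Fin c
    code i (inj₁ g) = inj₂ (label i g)
    code i (inj₂ e) = inj₁ (newEdgeIndex F e)

    code-injective : ∀ {i j} ei ej → code i ei ≡ code j ej → i ≡ j
    code-injective (inj₁ gi) (inj₁ gj) eq = label-injective gi gj (inj₂-injective eq)
    code-injective {i} {j} (inj₂ ei) (inj₂ ej) eq =
      step-injective (SameEdge-trans (lookup-newEdgeIndex F ei) (SameEdge-sym sameAsJ))
      where
        sameAsJ : SameEdge (step j) (lookup F (newEdgeIndex F ei))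
        sameAsJ = subst (λ x → SameEdge (step j) (lookup F x)) (sym (inj₁-injective eq))
                        (lookup-newEdgeIndex F ej)

    join-injective : Injective _≡_ _≡_ (join (length F) c)
    join-injective {x} {y} eq =
      trans (sym (splitAt-join (length F) c x)) (trans (cong (splitAt (length F)) eq) (splitAt-join (length F) c y))

  steps≤newEdges+labels : N ≤ length F + c
  steps≤newEdges+labels = injective⇒≤ (λ eq → code-injective (walk _) (walk _) (join-injective eq))

hamPath⇒walk : ∀ {N} (G : Graph (suc N)) → HasHamPath G →
               Σ (Fin (suc N) → Fin (suc N)) λ p →
                 Injective _≡_ _≡_ p × (∀ i → G (p (inject₁ i)) (p (suc i)))
hamPath⇒walk G (p , (p-injective , _) , adjacent) =
  p , p-injective , λ i → adjacent (inject₁ i) (suc i) (cong suc (toℕ-inject₁ i))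

identity-hamPath : ∀ {N} (G : Graph (suc N)) → (∀ i → G (inject₁ i) (suc i)) → HasHamPath G
identity-hamPath G adjacent = id , bijective _≡_ , consecutive
  where
    consecutive : ∀ i j → suc (toℕ i) ≡ toℕ j → G i j
    consecutive i (suc j) e = subst (λ v → G v (suc j)) i≡j (adjacent j)
      where
        i≡j : inject₁ j ≡ i
        i≡j = toℕ-injective (trans (toℕ-inject₁ j) (sym (ℕ.suc-injective e)))

-- For k = s + 2 the hub v_k is the vertex s + 1.  Read in the direction of a path,
-- an edge starts at the hub, ends at it, or is one of the s spine edges {l, l + 1}
-- avoiding it.
data CaterpillarEdgeView (s : ℕ) (x y : ℕ) : Set where
  from-hub : x ≡ suc s → CaterpillarEdgeView s x y
  to-hub   : y ≡ suc s → CaterpillarEdgeView s x y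
  spine    : (l : Fin s) → SameEdge (x , y) (toℕ l , suc (toℕ l)) → CaterpillarEdgeView s x y

CaterpillarEdgeView-swap : ∀ {s x y} → CaterpillarEdgeView s x y → CaterpillarEdgeView s y x
CaterpillarEdgeView-swap (from-hub x≡h) = to-hub x≡h
CaterpillarEdgeView-swap (to-hub y≡h)   = from-hub y≡h
CaterpillarEdgeView-swap (spine l e)    = spine l (SameEdge-swap e)

spineEdge-view : ∀ {s x y} → suc x ≡ y → y < suc (suc s) → CaterpillarEdgeView s x y
spineEdge-view refl (s≤s y≤h) with m≤n⇒m<n∨m≡n y≤h
... | inj₂ y≡h        = to-hub y≡h
... | inj₁ (s≤s x<s) rewrite sym (toℕ-fromℕ< x<s) = spine (fromℕ< x<s) (inj₁ refl)

caterpillarEdgeView : ∀ s m {u v : Fin (suc (suc s) + m)} →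
                      caterpillarEdge (suc (suc s)) m u v → CaterpillarEdgeView s (toℕ u) (toℕ v)
caterpillarEdgeView s m (inj₁ (1+u≡v , v<k)) = spineEdge-view 1+u≡v v<k
caterpillarEdgeView s m (inj₂ (u≡h , _))     = from-hub u≡h

caterpillar-view : ∀ s m {u v : Fin (suc (suc s) + m)} →
                   caterpillar (suc (suc s)) m u v → CaterpillarEdgeView s (toℕ u) (toℕ v)
caterpillar-view s m (inj₁ uv) = caterpillarEdgeView s m uv
caterpillar-view s m (inj₂ vu) = CaterpillarEdgeView-swap (caterpillarEdgeView s m vu)

edgeLabel : ∀ {s x y} → CaterpillarEdgeView s x y → Fin (suc (suc s))
edgeLabel (from-hub _) = zero
edgeLabel (to-hub _)   = suc zero
edgeLabel (spine l _)  = suc (suc l)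

module _ {N : ℕ} (q : Fin (suc N) → ℕ) (q-injective : Injective _≡_ _≡_ q) where

  open InjectiveSequence q q-injective

  edgeLabel-injective : ∀ {s i j} (vi : CaterpillarEdgeView s (q (inject₁ i)) (q (suc i)))
                        (vj : CaterpillarEdgeView s (q (inject₁ j)) (q (suc j))) →
                        edgeLabel vi ≡ edgeLabel vj → i ≡ j
  edgeLabel-injective (from-hub ei) (from-hub ej) _ = source-injective (trans ei (sym ej))
  edgeLabel-injective (to-hub ei)   (to-hub ej)   _ = target-injective (trans ei (sym ej))
  edgeLabel-injective (spine l ei)  (spine .l ej) refl = step-injective (SameEdge-trans ei (SameEdge-sym ej))
  edgeLabel-injective (from-hub _)  (to-hub _)   ()
  edgeLabel-injective (from-hub _)  (spine _ _)  ()
  edgeLabel-injective (to-hub _)    (from-hub _) ()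
  edgeLabel-injective (to-hub _)    (spine _ _)  ()
  edgeLabel-injective (spine _ _)   (from-hub _) ()
  edgeLabel-injective (spine _ _)   (to-hub _)   ()

caterpillar-completion-length≥ : ∀ s m F → HamCompletion (caterpillar (suc (suc s)) m) F →
                                 m ∸ 1 ≤ length F
caterpillar-completion-length≥ s m F (_ , hamPath)
  with hamPath⇒walk (addEdges (caterpillar (suc (suc s)) m) F) hamPath
... | p , p-injective , walk =
  ∸-monoˡ-≤ 1 (+-cancelˡ-≤ (suc s) m (suc (length F)) (subst (suc s + m ≤_) rearrange steps≤))
  where
    steps≤ : suc s + m ≤ length F + suc (suc s)
    steps≤ = steps≤newEdges+labels {G = caterpillar (suc (suc s)) m} {F = F} p p-injective walk
      (λ _ g → edgeLabel (caterpillar-view s m g))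
      (λ gi gj → edgeLabel-injective (λ v → toℕ (p v)) (λ eq → p-injective (toℕ-injective eq))
                   (caterpillar-view s m gi) (caterpillar-view s m gj))

    rearrange : length F + suc (suc s) ≡ suc s + suc (length F)
    rearrange = trans (+-comm (length F) (suc (suc s))) (sym (+-suc (suc s) (length F)))

leaves-nonadjacent : ∀ h m {u v : Fin (suc h + m)} → suc h ≤ toℕ u → suc h ≤ toℕ v →
                     ¬ caterpillar (suc h) m u v
leaves-nonadjacent h m {u} {v} h<u h<v (inj₁ uv) = no-edge h<u h<v uv
  where
    no-edge : ∀ {x y : Fin (suc h + m)} → suc h ≤ toℕ x → suc h ≤ toℕ y → ¬ caterpillarEdge (suc h) m x y
    no-edge _   h<y (inj₁ (_ , y<k)) = <⇒≱ y<k h<y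
    no-edge h<x _   (inj₂ (x≡h , _)) = 1+n≰n (subst (suc h ≤_) x≡h h<x)
leaves-nonadjacent h m {u} {v} h<u h<v (inj₂ vu) = leaves-nonadjacent h m h<v h<u (inj₁ vu)

-- Vertices are Fin (1 + h + (1 + m)) with hub h; the step i = h + 1 + t of the
-- identity ordering joins the leaves h + 1 + t and h + 2 + t.
module LeafChain (h m : ℕ) where

  link : Fin m → Fin (suc h + suc m) × Fin (suc h + suc m)
  link t = inject₁ (h ↑ʳ suc t) , suc (h ↑ʳ suc t)

  leafChain : List (Fin (suc h + suc m) × Fin (suc h + suc m))
  leafChain = tabulate link

  link-injective : ∀ {t t′} → link t ≡ link t′ → t ≡ t′
  link-injective eq = suc-injective (↑ʳ-injective h _ _ (inject₁-injective (proj₁ (,-injective eq))))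

  hub<leaf : ∀ (t : Fin m) → suc h ≤ toℕ (h ↑ʳ suc t)
  hub<leaf t = subst (suc h ≤_) (sym (trans (toℕ-↑ʳ h (suc t)) (+-suc h (toℕ t))))
                     (s≤s (ℕ.m≤m+n h (toℕ t)))

  link-valid : ∀ t → let (u , v) = link t in toℕ u < toℕ v × ¬ caterpillar (suc h) (suc m) u v
  link-valid t = ≤̄⇒inject₁< ℕ.≤-refl
               , leaves-nonadjacent h (suc m) (subst (suc h ≤_) (sym (toℕ-inject₁ _)) (hub<leaf t))
                                              (ℕ.m≤n⇒m≤1+n (hub<leaf t))

  identity-adjacent : ∀ i → addEdges (caterpillar (suc h) (suc m)) leafChain (inject₁ i) (suc i)
  identity-adjacent i with splitAt h i in split
  ... | inj₁ a = inj₁ (inj₁ (inj₁ (cong suc (toℕ-inject₁ i) , s≤s i<h)))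
    where
      i<h : toℕ i < h
      i<h = subst (_< h) (trans (sym (toℕ-↑ˡ a (suc m))) (cong toℕ (splitAt⁻¹-↑ˡ split))) (toℕ<n a)
  ... | inj₂ zero = inj₁ (inj₁ (inj₂ (i≡h , s≤s (ℕ.≤-reflexive (sym i≡h′)))))
    where
      i≡h′ : toℕ i ≡ h
      i≡h′ = trans (cong toℕ (sym (splitAt⁻¹-↑ʳ split))) (trans (toℕ-↑ʳ h zero) (+-identityʳ h))
      i≡h : toℕ (inject₁ i) ≡ h
      i≡h = trans (toℕ-inject₁ i) i≡h′
  ... | inj₂ (suc t) = inj₂ (inj₁ (subst (_∈ leafChain) link≡step (∈-tabulate⁺ t)))
    where
      link≡step : link t ≡ (inject₁ i , suc i)
      link≡step = cong (λ j → inject₁ j , suc j) (splitAt⁻¹-↑ʳ split)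

  leafChain-completion : HamCompletion (caterpillar (suc h) (suc m)) leafChain
  leafChain-completion = (Unique.tabulate⁺ link-injective , All.tabulate⁺ link-valid)
                       , identity-hamPath (addEdges (caterpillar (suc h) (suc m)) leafChain) identity-adjacent

caterpillar-completion : ∀ h m → Σ _ λ F → HamCompletion (caterpillar (suc h) (suc m)) F × length F ≡ m
caterpillar-completion h m = leafChain , leafChain-completion , length-tabulate link
  where open LeafChain h m

mainTheorem5 : (k m : ℕ) → 3 ≤ k → 2 ≤ m →
    HamPathCompleteNumberIs (caterpillar k m) (m ∸ 1)
mainTheorem5 (suc (suc s)) (suc m) (s≤s (s≤s _)) (s≤s _) =
  caterpillar-completion (suc s) m , caterpillar-completion-length≥ s (suc m)
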